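{- Fix a base $b\ge 2$ and a positive integer $M$. Then the set of $b$-MRH numbers having $M$ as a multiplicative multiplier is finite.
   Context: For a positive integer $N$, $s_b(N)$ is the sum of the base-$b$ digits of $N$, and the reversal $N^R$ is the integer obtained by writing the base-$b$ digits of $N$ in reverse order. A positive integer $N$ is a $b$-MRH number if there exists a positive integer $M$ (called a multiplicative multiplier of $N$) such that $N=Ms_b(N)\cdot(Ms_b(N))^R$. -}

module Defs where

open import Data.Nat using (ℕ; zero; suc; _+_; _*_; _≤_; _<_; NonZero)
open import Data.Nat.DivMod using (_/_; _%_)
open import Data.List using (List; []; _∷_; reverse; foldr)
open import Data.Nat.ListAction using (sum)
open import Relation.Binary.PropositionalEquality using (_≡_)
open import Data.Product using (∃; _×_)

-- With fuel ≥ n the result is exactly the standard digit list (no leading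
-- zeros; the empty list for n = 0), since each step replaces n by n / b < n.
digitsAux : (b : ℕ) → .{{NonZero b}} → (fuel n : ℕ) → List ℕ
digitsAux b zero    n       = []
digitsAux b (suc f) zero    = []
digitsAux b (suc f) (suc n) = (suc n % b) ∷ digitsAux b f (suc n / b)

digits : (b : ℕ) → .{{NonZero b}} → ℕ → List ℕ
digits b n = digitsAux b n n

fromDigits : (b : ℕ) → List ℕ → ℕ
fromDigits b = foldr (λ d acc → d + b * acc) 0

digitSum : (b : ℕ) → .{{NonZero b}} → ℕ → ℕ
digitSum b n = sum (digits b n)

rev : (b : ℕ) → .{{NonZero b}} → ℕ → ℕ
rev b n = fromDigits b (reverse (digits b n))

IsMultiplier : (b : ℕ) → .{{NonZero b}} → (M N : ℕ) → Set
IsMultiplier b M N = N ≡ (M * digitSum b N) * rev b (M * digitSum b N)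

IsMRHWith : (b : ℕ) → .{{NonZero b}} → (M N : ℕ) → Set
IsMRHWith b M N = 0 < N × IsMultiplier b M N

module Submission where

-- Write b = c + 1 (c ≥ 1), s = s_b(N) and K = M·s.
--   (1) Reversal is short:  K^R < b^(number of digits of K) ≤ b·K,
--       so a multiplier equation N = K·K^R gives  N ≤ b·M²·s².
--   (2) Digit sums grow like a cube root at most:
--         (s_b(n) + 4c)³ ≤ (5c)³ · n      for every n ≥ 1,
--       by induction on the digits (adding one digit d ≤ c to a number
--       at most doubles the cube, while the number gets multiplied by b ≥ 2).
--   (3) Combining, (s + 4c)³ ≤ (5c)³·b·M²·s² ≤ D·(s + 4c)² with
--       D = (5c)³·b·M², hence s ≤ D, and by (1)  N ≤ b·(M·D)².

open import Defs
open import Data.Nat using (ℕ; _≤_; _<_; NonZero; >-nonZero⁻¹; zero; suc; _+_; _*_; _^_; z≤n; s≤s)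
open import Data.Nat.Properties
open import Data.Nat.DivMod using (_/_; _%_; m%n<n; m/n*n≤m)
open import Data.List using ([]; _∷_; reverse; length)
open import Data.List.Properties using (length-reverse)
open import Data.List.Relation.Unary.All using (All; []; _∷_)
open import Data.List.Relation.Binary.Permutation.Propositional using (↭-sym)
open import Data.List.Relation.Binary.Permutation.Propositional.Properties
  using (All-resp-↭; ↭-reverse)
open import Data.Nat.ListAction using (sum)
open import Data.Product using (∃; _,_)
open import Relation.Binary.PropositionalEquality
open import Data.Nat.Solver using (module +-*-Solver)
open +-*-Solver

digitsAux-zero : ∀ b .{{_ : NonZero b}} f → digitsAux b f 0 ≡ []
digitsAux-zero b zero    = refl
digitsAux-zero b (suc f) = refl

digitsAux-< : ∀ b .{{_ : NonZero b}} f n → All (_< b) (digitsAux b f n)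
digitsAux-< b zero    n       = []
digitsAux-< b (suc f) zero    = []
digitsAux-< b (suc f) (suc n) = m%n<n (suc n) b ∷ digitsAux-< b f (suc n / b)

b*[n/b]≤n : ∀ n b .{{_ : NonZero b}} → b * (n / b) ≤ n
b*[n/b]≤n n b = subst (_≤ n) (*-comm (n / b) b) (m/n*n≤m n b)

fromDigits-< : ∀ b ds → All (_< b) ds → fromDigits b ds < b ^ length ds
fromDigits-< b []       []          = ≤-refl
fromDigits-< b (d ∷ ds) (d<b ∷ ds<b) = begin
    suc (d + b * x) ≤⟨ +-monoˡ-≤ (b * x) d<b ⟩
    b + b * x       ≡⟨ sym (*-suc b x) ⟩
    b * suc x       ≤⟨ *-monoʳ-≤ b (fromDigits-< b ds ds<b) ⟩
    b * b ^ length ds ∎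
  where
    open ≤-Reasoning
    x = fromDigits b ds

^length-digitsAux : ∀ b .{{_ : NonZero b}} f n → 1 ≤ n →
  b ^ length (digitsAux b f n) ≤ b * n
^length-digitsAux b zero    (suc n) _ = ≤-trans (>-nonZero⁻¹ b) (m≤m*n b (suc n))
^length-digitsAux b (suc f) (suc n) _ with suc n / b in n/b≡
... | zero rewrite digitsAux-zero b f = *-monoʳ-≤ b (s≤s z≤n)
... | suc m = begin
    b * b ^ length (digitsAux b f (suc m)) ≤⟨ *-monoʳ-≤ b (^length-digitsAux b f (suc m) (s≤s z≤n)) ⟩
    b * (b * suc m)                        ≤⟨ *-monoʳ-≤ b (subst (λ q → b * q ≤ suc n) n/b≡ (b*[n/b]≤n (suc n) b)) ⟩
    b * suc n                              ∎
  where open ≤-Reasoning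

-- The reversal of K is at most b·K (it has the same digits as K).
rev-≤ : ∀ b .{{_ : NonZero b}} K → rev b K ≤ b * K
rev-≤ b zero    = z≤n
rev-≤ b (suc K) = <⇒≤ (begin-strict
    fromDigits b (reverse ds) <⟨ fromDigits-< b (reverse ds) (All-resp-↭ (↭-sym (↭-reverse ds)) (digitsAux-< b (suc K) (suc K))) ⟩
    b ^ length (reverse ds)   ≡⟨ cong (b ^_) (length-reverse ds) ⟩
    b ^ length ds             ≤⟨ ^length-digitsAux b (suc K) (suc K) (s≤s z≤n) ⟩
    b * suc K                 ∎)
  where
    open ≤-Reasoning
    ds = digitsAux b (suc K) (suc K)

cube : ℕ → ℕ
cube x = x * x * x

cube-mono : ∀ {x y} → x ≤ y → cube x ≤ cube y
cube-mono x≤y = *-mono-≤ (*-mono-≤ x≤y x≤y) x≤y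

-- Adding a quantity at most x/4 to x at most doubles the cube, since (5/4)³ < 2.
cube-step : ∀ d x → 4 * d ≤ x → cube (d + x) ≤ 2 * cube x
cube-step d x 4d≤x = *-cancelˡ-≤ 64 (begin
    64 * cube (d + x)  ≡⟨ solve 2 (λ d x → con 64 :* ((d :+ x) :* (d :+ x) :* (d :+ x)) :=
                            (con 4 :* (d :+ x)) :* (con 4 :* (d :+ x)) :* (con 4 :* (d :+ x))) refl d x ⟩
    cube (4 * (d + x)) ≤⟨ cube-mono 4[d+x]≤5x ⟩
    cube (5 * x)       ≡⟨ solve 1 (λ x → (con 5 :* x) :* (con 5 :* x) :* (con 5 :* x) :=
                            con 125 :* (x :* x :* x)) refl x ⟩
    125 * cube x       ≤⟨ *-monoˡ-≤ (cube x) (m≤m+n 125 3) ⟩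
    128 * cube x       ≡⟨ solve 1 (λ y → con 128 :* y := con 64 :* (con 2 :* y)) refl (cube x) ⟩
    64 * (2 * cube x)  ∎)
  where
    open ≤-Reasoning
    4[d+x]≤5x : 4 * (d + x) ≤ 5 * x
    4[d+x]≤5x = begin
      4 * (d + x)   ≡⟨ *-distribˡ-+ 4 d x ⟩
      4 * d + 4 * x ≤⟨ +-monoˡ-≤ (4 * x) 4d≤x ⟩
      x + 4 * x     ≡⟨ solve 1 (λ x → x :+ con 4 :* x := con 5 :* x) refl x ⟩
      5 * x         ∎

cube-cancel : ∀ t D → cube t ≤ D * (t * t) → t ≤ D
cube-cancel zero    D _         = z≤n
cube-cancel (suc t) D t³≤D·t² = *-cancelˡ-≤ (suc t * suc t) (subst (cube (suc t) ≤_) (*-comm D _) t³≤D·t²)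

-- Growth of digit sums: in base c + 1 ≥ 2, (s(n) + 4c)³ ≤ (5c)³·n for n ≥ 1.
-- Stated for any fuel so that the induction can follow the digit recursion.
digitSumAux-cube : ∀ c → 1 ≤ c → ∀ f n → 1 ≤ n →
  cube (sum (digitsAux (suc c) f n) + 4 * c) ≤ cube (5 * c) * n
digitSumAux-cube c _ zero (suc n) _ =
  ≤-trans (cube-mono (*-monoˡ-≤ c (m≤n+m 4 1))) (m≤m*n (cube (5 * c)) (suc n))
digitSumAux-cube c 1≤c (suc f) (suc n) _ with suc n / suc c in n/b≡
... | zero rewrite digitsAux-zero (suc c) f | +-identityʳ (suc n % suc c) =
  ≤-trans (cube-mono d+4c≤5c) (m≤m*n (cube (5 * c)) (suc n))
  where
    d = suc n % suc c
    d+4c≤5c : d + 4 * c ≤ 5 * c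
    d+4c≤5c = +-monoˡ-≤ (4 * c) (≤-pred (m%n<n (suc n) (suc c)))
... | suc m = begin
    cube (d + S + 4 * c)   ≡⟨ cong cube (+-assoc d S (4 * c)) ⟩
    cube (d + (S + 4 * c)) ≤⟨ cube-step d (S + 4 * c) 4d≤S+4c ⟩
    2 * cube (S + 4 * c)   ≤⟨ *-monoʳ-≤ 2 (digitSumAux-cube c 1≤c f (suc m) (s≤s z≤n)) ⟩
    2 * (C * suc m)        ≡⟨ solve 2 (λ C m → con 2 :* (C :* m) := C :* (con 2 :* m)) refl C (suc m) ⟩
    C * (2 * suc m)        ≤⟨ *-monoʳ-≤ C 2m≤n ⟩
    C * suc n              ∎
  where
    open ≤-Reasoning
    d = suc n % suc c
    S = sum (digitsAux (suc c) f (suc m))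
    C = cube (5 * c)
    4d≤S+4c : 4 * d ≤ S + 4 * c
    4d≤S+4c = ≤-trans (*-monoʳ-≤ 4 (≤-pred (m%n<n (suc n) (suc c)))) (m≤n+m (4 * c) S)
    2m≤n : 2 * suc m ≤ suc n
    2m≤n = ≤-trans (*-monoˡ-≤ (suc m) (s≤s 1≤c))
                   (subst (λ q → suc c * q ≤ suc n) n/b≡ (b*[n/b]≤n (suc n) (suc c)))

multiplier-bound : ∀ b .{{_ : NonZero b}} M N → IsMultiplier b M N →
  N ≤ b * (M * digitSum b N) * (M * digitSum b N)
multiplier-bound b M N N≡K·Kᴿ = begin
    N           ≡⟨ N≡K·Kᴿ ⟩
    K * rev b K ≤⟨ *-monoʳ-≤ K (rev-≤ b K) ⟩
    K * (b * K) ≡⟨ solve 2 (λ K b → K :* (b :* K) := b :* K :* K) refl K b ⟩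
    b * K * K   ∎
  where
    open ≤-Reasoning
    K = M * digitSum b N

digitSumBound : ℕ → ℕ → ℕ
digitSumBound c M = cube (5 * c) * (suc c * (M * M))

-- Since N ≤ b·M²·s² while s³ ≲ N, the digit sum s of N is at most D.
mrh-digitSum-≤ : ∀ c → 1 ≤ c → ∀ M N → IsMRHWith (suc c) M N →
  digitSum (suc c) N ≤ digitSumBound c M
mrh-digitSum-≤ c 1≤c M N (0<N , isMult) =
  ≤-trans (m≤m+n s (4 * c)) (cube-cancel t D t³≤D·t²)
  where
    open ≤-Reasoning
    s = digitSum (suc c) N
    t = s + 4 * c
    C = cube (5 * c)
    D = digitSumBound c M
    t³≤D·t² : cube t ≤ D * (t * t)
    t³≤D·t² = begin
      cube t                             ≤⟨ digitSumAux-cube c 1≤c N N 0<N ⟩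
      C * N                              ≤⟨ *-monoʳ-≤ C (multiplier-bound (suc c) M N isMult) ⟩
      C * (suc c * (M * s) * (M * s))    ≡⟨ solve 4 (λ C b M s → C :* (b :* (M :* s) :* (M :* s)) :=
                                              C :* (b :* (M :* M)) :* (s :* s)) refl C (suc c) M s ⟩
      D * (s * s)                        ≤⟨ *-monoʳ-≤ D (*-mono-≤ (m≤m+n s (4 * c)) (m≤m+n s (4 * c))) ⟩
      D * (t * t)                        ∎

-- A set of naturals is finite iff it is bounded: every b-MRH number with
-- multiplier M is at most b·(M·D)².
corollary39 : (b : ℕ) → 2 ≤ b → .{{_ : NonZero b}} → (M : ℕ) → 0 < M →
    ∃ λ B → ∀ N → IsMRHWith b M N → N ≤ B
corollary39 (suc c) (s≤s 1≤c) M _ = suc c * (M * D) * (M * D) , N≤B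
  where
    D = digitSumBound c M
    N≤B : ∀ N → IsMRHWith (suc c) M N → N ≤ suc c * (M * D) * (M * D)
    N≤B N mrh@(_ , isMult) =
      let MsD = *-monoʳ-≤ M (mrh-digitSum-≤ c 1≤c M N mrh)
      in ≤-trans (multiplier-bound (suc c) M N isMult) (*-mono-≤ (*-monoʳ-≤ (suc c) MsD) MsD)
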